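{- Let $G=(V,E_G)$ be the rectangular grid graph with vertices $(x,y)$, $1\le x\le n$, $1\le y\le m$, adjacent iff they differ by $1$ in exactly one coordinate. Let $E=(x_E,y_E)$, $F=(x_F,y_F)\in V$ satisfy: $x_F\le x_E$, $y_E\le y_F$, $x_E-x_F\le y_F-y_E$; $x_F\ne x_E$; ${\rm Gain}'\ge 2$, where ${\rm Gain}'=\max\big(0,\big||y_F-y_E|-|x_E-x_F|\big|-1\big)$; and neither $E$ nor $F$ lies on the boundary of the grid (i.e. $1<x_E,x_F<n$ and $1<y_E,y_F<m$). Let $G'=(V,E_G\cup\{EF\})$. Then $\beta(G')\ge 3$.
   Context: For a connected graph $H$, a set $R$ of vertices is resolving if every pair of distinct vertices $A\ne B$ has some $X\in R$ with $d_H(A,X)\ne d_H(B,X)$, where $d_H$ is shortest-path distance; the metric dimension $\beta(H)$ is the minimum size of a resolving set. -}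

module Defs where

open import Data.Nat using (ℕ; zero; suc; _≤_; ∣_-_∣)
open import Data.Fin using (Fin; toℕ)
open import Data.Product using (_×_; Σ; ∃; _,_; proj₁; proj₂)
open import Data.Sum using (_⊎_)
open import Data.List using (List; length)
open import Data.List.Membership.Propositional using (_∈_)
open import Relation.Binary.PropositionalEquality using (_≡_)
open import Relation.Nullary using (¬_)

-- Vertices of the n × m grid: (i , j) represents (x , y) = (toℕ i + 1 , toℕ j + 1),
-- so 1 ≤ x ≤ n and 1 ≤ y ≤ m.
Vertex : ℕ → ℕ → Set
Vertex n m = Fin n × Fin m

xc : ∀ {n m} → Vertex n m → ℕ
xc (i , _) = suc (toℕ i)

yc : ∀ {n m} → Vertex n m → ℕ
yc (_ , j) = suc (toℕ j)

GridAdj : ∀ {n m} → Vertex n m → Vertex n m → Set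
GridAdj A B = (xc A ≡ xc B × ∣ yc A - yc B ∣ ≡ 1) ⊎ (yc A ≡ yc B × ∣ xc A - xc B ∣ ≡ 1)

GridAdj+ : ∀ {n m} → Vertex n m → Vertex n m → Vertex n m → Vertex n m → Set
GridAdj+ E F A B = GridAdj A B ⊎ ((A ≡ E × B ≡ F) ⊎ (A ≡ F × B ≡ E))

data Walk {V : Set} (Adj : V → V → Set) : V → V → ℕ → Set where
  here : ∀ {a} → Walk Adj a a zero
  step : ∀ {a b c k} → Adj a b → Walk Adj b c k → Walk Adj a c (suc k)

Dist : {V : Set} → (V → V → Set) → V → V → ℕ → Set
Dist Adj a b k = Walk Adj a b k × (∀ j → Walk Adj a b j → k ≤ j)

Resolving : {V : Set} → (V → V → Set) → List V → Set
Resolving {V} Adj R = ∀ (a b : V) → ¬ (a ≡ b) →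
  Σ V λ x → x ∈ R × Σ ℕ λ k → Σ ℕ λ l → Dist Adj a x k × Dist Adj b x l × ¬ (k ≡ l)

MetricDimAtLeast : {V : Set} → (V → V → Set) → ℕ → Set
MetricDimAtLeast {V} Adj c = ∀ (R : List V) → Resolving Adj R → c ≤ length R

-- In G′ the distance is the least of the grid distance and the two routes through the edge
-- EF, so it suffices to find, for any two landmarks X and Y, two distinct vertices at equal
-- distances from both.  If X is interior, two of its four neighbours qualify: their distances
-- to Y lie within 1 of that of X.  Otherwise both landmarks are on the boundary.  The two
-- antidiagonal (diagonal) corners of a unit cell are equidistant from every point comparable
-- (incomparable) with the cell in the product order, so such a pair is unresolved as soon as
-- X, Y, E and F all are.  The cells at the four corners of the grid settle every boundary pair
-- except opposite corners and points on opposite sides; those are settled by cells placed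
-- relative to E and F, or by two neighbours of E or of F whose distance to a landmark is
-- capped by the shortcut.  The gain hypothesis, which makes EF steep, enters these distance
-- estimates and makes the shortcut useless between points of nearly equal height.

module Submission where

open import Defs
open import Data.Nat using (ℕ; zero; suc; _+_; _*_; _≤_; _<_; _∸_; ∣_-_∣; _⊓_; z≤n; s≤s; _≟_; _≤?_; _<?_)
open import Data.Nat.Properties
open import Data.Nat.Tactic.RingSolver using (solve-∀; solve)
open import Data.Fin using (Fin; toℕ; fromℕ<; zero; suc)
import Data.Fin as Fin
open import Data.Fin.Properties using (toℕ-injective; toℕ-fromℕ<; toℕ<n; pigeonhole)
import Data.Fin.Properties as Finₚ
open import Data.Product using (_×_; Σ; ∃; ∃₂; _,_; proj₁; proj₂)
open import Data.Sum using (_⊎_; inj₁; inj₂)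
open import Data.Empty using (⊥-elim)
open import Data.List using (List; []; _∷_)
open import Data.List.Relation.Unary.Any using (here; there)
open import Data.List.Membership.Propositional using (_∈_)
open import Relation.Binary.PropositionalEquality
open import Relation.Binary.Definitions using (tri<; tri≈; tri>)
open import Relation.Nullary using (¬_; yes; no)
open import Function using (_∘_)
open import Algebra.Properties.CommutativeSemigroup +-commutativeSemigroup using (interchange; xy∙z≈xz∙y)

Point : Set
Point = ℕ × ℕ

manhattan : Point → Point → ℕ
manhattan (x , y) (u , v) = ∣ x - u ∣ + ∣ y - v ∣

manhattan-self : ∀ P → manhattan P P ≡ 0
manhattan-self (x , y) = cong₂ _+_ (∣n-n∣≡0 x) (∣n-n∣≡0 y)

manhattan-sym : ∀ P Q → manhattan P Q ≡ manhattan Q P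
manhattan-sym (x , y) (u , v) = cong₂ _+_ (∣-∣-comm x u) (∣-∣-comm y v)

manhattan-triangle : ∀ P Q R → manhattan P R ≤ manhattan P Q + manhattan Q R
manhattan-triangle (x , y) (u , v) (s , t) = begin
  ∣ x - s ∣ + ∣ y - t ∣                           ≤⟨ +-mono-≤ (∣-∣-triangle x u s) (∣-∣-triangle y v t) ⟩
  (∣ x - u ∣ + ∣ u - s ∣) + (∣ y - v ∣ + ∣ v - t ∣) ≡⟨ interchange ∣ x - u ∣ ∣ u - s ∣ ∣ y - v ∣ ∣ v - t ∣ ⟩
  (∣ x - u ∣ + ∣ y - v ∣) + (∣ u - s ∣ + ∣ v - t ∣) ∎
  where open ≤-Reasoning

-- Through an edge UV spanning H columns and W rows, the route overshoots vertically by at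
-- least W − ∣Δy∣ and gains at most H horizontally.
manhattan≤detour : ∀ (P U V Z : Point) →
  ∣ proj₁ U - proj₁ V ∣ + 2 * ∣ proj₂ P - proj₂ Z ∣ ≤ suc ∣ proj₂ U - proj₂ V ∣ →
  manhattan P Z ≤ suc (manhattan P U + manhattan V Z)
manhattan≤detour (p , s) (u , u′) (v , v′) (z , t) bound = +-cancelʳ-≤ W _ _ (begin
  (∣ p - z ∣ + D) + W                                          ≡⟨ xy∙z≈xz∙y ∣ p - z ∣ D W ⟩
  (∣ p - z ∣ + W) + D                                          ≤⟨ +-monoˡ-≤ D (+-mono-≤ horizontal vertical) ⟩
  ((∣ p - u ∣ + H + ∣ v - z ∣) + (∣ s - u′ ∣ + D + ∣ v′ - t ∣)) + D
    ≡⟨ regroup ∣ p - u ∣ H ∣ v - z ∣ ∣ s - u′ ∣ D ∣ v′ - t ∣ ⟩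
  (∣ p - u ∣ + ∣ s - u′ ∣ + (∣ v - z ∣ + ∣ v′ - t ∣)) + (H + 2 * D) ≤⟨ +-monoʳ-≤ _ bound ⟩
  (∣ p - u ∣ + ∣ s - u′ ∣ + (∣ v - z ∣ + ∣ v′ - t ∣)) + suc W
    ≡⟨ +-suc _ W ⟩
  suc (∣ p - u ∣ + ∣ s - u′ ∣ + (∣ v - z ∣ + ∣ v′ - t ∣)) + W ∎)
  where
  open ≤-Reasoning
  regroup : ∀ a h b c d e → (a + h + b) + (c + d + e) + d ≡ (a + c + (b + e)) + (h + 2 * d)
  regroup = solve-∀
  H = ∣ u - v ∣
  W = ∣ u′ - v′ ∣
  D = ∣ s - t ∣
  horizontal : ∣ p - z ∣ ≤ ∣ p - u ∣ + H + ∣ v - z ∣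
  horizontal = ≤-trans (∣-∣-triangle p v z) (+-monoˡ-≤ _ (∣-∣-triangle p u v))
  vertical : W ≤ ∣ s - u′ ∣ + D + ∣ v′ - t ∣
  vertical = begin
    W                                    ≤⟨ ∣-∣-triangle u′ t v′ ⟩
    ∣ u′ - t ∣ + ∣ t - v′ ∣                ≤⟨ +-monoˡ-≤ _ (∣-∣-triangle u′ s t) ⟩
    ∣ u′ - s ∣ + D + ∣ t - v′ ∣            ≡⟨ cong₂ (λ k l → k + D + l) (∣-∣-comm u′ s) (∣-∣-comm t v′) ⟩
    ∣ s - u′ ∣ + D + ∣ v′ - t ∣ ∎

∣n-1+n∣≡1 : ∀ n → ∣ n - suc n ∣ ≡ 1
∣n-1+n∣≡1 zero = refl
∣n-1+n∣≡1 (suc n) = ∣n-1+n∣≡1 n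

m≤n⇒∣1+n-m∣≡1+∣n-m∣ : ∀ {m n} → m ≤ n → ∣ suc n - m ∣ ≡ suc ∣ n - m ∣
m≤n⇒∣1+n-m∣≡1+∣n-m∣ {zero} {n} z≤n = cong suc (sym (∣-∣-identityʳ n))
m≤n⇒∣1+n-m∣≡1+∣n-m∣ (s≤s m≤n) = m≤n⇒∣1+n-m∣≡1+∣n-m∣ m≤n

m<n⇒∣m-n∣≡1+∣1+m-n∣ : ∀ {m n} → m < n → ∣ m - n ∣ ≡ suc ∣ suc m - n ∣
m<n⇒∣m-n∣≡1+∣1+m-n∣ {zero} (s≤s _) = refl
m<n⇒∣m-n∣≡1+∣1+m-n∣ {suc m} (s≤s m<n) = m<n⇒∣m-n∣≡1+∣1+m-n∣ m<n

∣-∣-monoˡ-≤ : ∀ {x y z} → x ≤ y → y ≤ z → ∣ y - x ∣ ≤ ∣ z - x ∣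
∣-∣-monoˡ-≤ {x} x≤y y≤z =
  subst₂ _≤_ (sym (m≤n⇒∣n-m∣≡n∸m x≤y)) (sym (m≤n⇒∣n-m∣≡n∸m (≤-trans x≤y y≤z))) (∸-monoˡ-≤ x y≤z)

∣m-n∣≡k : ∀ {m n} k → n ≡ m + k → ∣ m - n ∣ ≡ k
∣m-n∣≡k {m} k refl = ∣m-m+n∣≡n m k

∣n-m∣≡k : ∀ {m n} k → n ≡ m + k → ∣ n - m ∣ ≡ k
∣n-m∣≡k {m} k refl = trans (∣-∣-comm (m + k) m) (∣m-m+n∣≡n m k)

≤-by : ∀ {m n} k → m + k ≡ n → m ≤ n
≤-by {m} k refl = m≤m+n m k

cancel-offset : ∀ c {d} L s → L + s ≡ c + d → ∀ R → c + R ≡ L + s → d ≡ R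
cancel-offset c L s e R eR = +-cancelˡ-≡ c _ _ (trans (sym e) (sym eR))

-- The unit cell with lower-left corner (p , q) has the antidiagonal pair (p+1 , q), (p , q+1)
-- and the diagonal pair (p , q), (p+1 , q+1).
Comparable Incomparable : ℕ → ℕ → Point → Set
Comparable p q (x , y) = (x ≤ p × y ≤ q) ⊎ (suc p ≤ x × suc q ≤ y)
Incomparable p q (x , y) = (x ≤ p × suc q ≤ y) ⊎ (suc p ≤ x × y ≤ q)

antidiagonal-equidistant : ∀ {p q} Z → Comparable p q Z → manhattan (suc p , q) Z ≡ manhattan (p , suc q) Z
antidiagonal-equidistant {p} {q} (x , y) (inj₁ (x≤p , y≤q))
  rewrite m≤n⇒∣1+n-m∣≡1+∣n-m∣ x≤p | m≤n⇒∣1+n-m∣≡1+∣n-m∣ y≤q = sym (+-suc ∣ p - x ∣ ∣ q - y ∣)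
antidiagonal-equidistant {p} {q} (x , y) (inj₂ (p<x , q<y))
  rewrite m<n⇒∣m-n∣≡1+∣1+m-n∣ p<x | m<n⇒∣m-n∣≡1+∣1+m-n∣ q<y = +-suc ∣ suc p - x ∣ ∣ suc q - y ∣

diagonal-equidistant : ∀ {p q} Z → Incomparable p q Z → manhattan (p , q) Z ≡ manhattan (suc p , suc q) Z
diagonal-equidistant {p} {q} (x , y) (inj₁ (x≤p , q<y))
  rewrite m≤n⇒∣1+n-m∣≡1+∣n-m∣ x≤p | m<n⇒∣m-n∣≡1+∣1+m-n∣ q<y = +-suc ∣ p - x ∣ ∣ suc q - y ∣
diagonal-equidistant {p} {q} (x , y) (inj₂ (p<x , y≤q))
  rewrite m<n⇒∣m-n∣≡1+∣1+m-n∣ p<x | m≤n⇒∣1+n-m∣≡1+∣n-m∣ y≤q = sym (+-suc ∣ suc p - x ∣ ∣ q - y ∣)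

antidiagonal-gap-above-left : ∀ {p q x y} → x ≤ p → suc q ≤ y →
  manhattan (suc p , q) (x , y) ≡ 2 + manhattan (p , suc q) (x , y)
antidiagonal-gap-above-left {p} {q} {x} {y} x≤p q<y
  rewrite m≤n⇒∣1+n-m∣≡1+∣n-m∣ x≤p | m<n⇒∣m-n∣≡1+∣1+m-n∣ q<y = cong suc (+-suc ∣ p - x ∣ ∣ suc q - y ∣)

antidiagonal-gap-below-right : ∀ {p q x y} → suc p ≤ x → y ≤ q →
  manhattan (p , suc q) (x , y) ≡ 2 + manhattan (suc p , q) (x , y)
antidiagonal-gap-below-right {p} {q} {x} {y} p<x y≤q
  rewrite m<n⇒∣m-n∣≡1+∣1+m-n∣ p<x | m≤n⇒∣1+n-m∣≡1+∣n-m∣ y≤q = cong suc (+-suc ∣ suc p - x ∣ ∣ q - y ∣)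

diagonal-gap-below-left : ∀ {p q x y} → x ≤ p → y ≤ q →
  manhattan (suc p , suc q) (x , y) ≡ 2 + manhattan (p , q) (x , y)
diagonal-gap-below-left {p} {q} {x} {y} x≤p y≤q
  rewrite m≤n⇒∣1+n-m∣≡1+∣n-m∣ x≤p | m≤n⇒∣1+n-m∣≡1+∣n-m∣ y≤q = cong suc (+-suc ∣ p - x ∣ ∣ q - y ∣)

antidiagonal-next-to-corner : ∀ p q →
  manhattan (suc p , q) (suc p , suc q) ≡ 1 × manhattan (p , suc q) (suc p , suc q) ≡ 1
antidiagonal-next-to-corner p q = cong₂ _+_ (∣n-n∣≡0 p) (∣n-1+n∣≡1 q) , cong₂ _+_ (∣n-1+n∣≡1 p) (∣n-n∣≡0 q)

diagonal-next-to-corner : ∀ p q →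
  manhattan (p , q) (suc p , q) ≡ 1 × manhattan (suc p , suc q) (suc p , q) ≡ 1
diagonal-next-to-corner p q =
  cong₂ _+_ (∣n-1+n∣≡1 p) (∣n-n∣≡0 q) , cong₂ _+_ (∣n-n∣≡0 p) (trans (∣-∣-comm (suc q) q) (∣n-1+n∣≡1 q))

⊓-agree : ∀ {k l b} → k ≡ l ⊎ (b ≤ k × b ≤ l) → k ⊓ b ≡ l ⊓ b
⊓-agree (inj₁ refl) = refl
⊓-agree (inj₂ (b≤k , b≤l)) = trans (m≥n⇒m⊓n≡n b≤k) (sym (m≥n⇒m⊓n≡n b≤l))

module Shortcut (E F : Point) where

  -- The distance in the grid with the extra edge EF, which a shortest walk uses at most once.
  viaEF viaFE dist′ : Point → Point → ℕ
  viaEF P Z = suc (manhattan P E + manhattan F Z)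
  viaFE P Z = suc (manhattan P F + manhattan E Z)
  dist′ P Z = manhattan P Z ⊓ viaEF P Z ⊓ viaFE P Z

  dist′≤manhattan : ∀ P Z → dist′ P Z ≤ manhattan P Z
  dist′≤manhattan P Z = ≤-trans (m⊓n≤m _ _) (m⊓n≤m _ _)

  dist′≤viaEF : ∀ P Z → dist′ P Z ≤ viaEF P Z
  dist′≤viaEF P Z = ≤-trans (m⊓n≤m _ _) (m⊓n≤n _ _)

  dist′≤viaFE : ∀ P Z → dist′ P Z ≤ viaFE P Z
  dist′≤viaFE P Z = m⊓n≤n _ _

  ≤dist′ : ∀ P Z {k} → k ≤ manhattan P Z → k ≤ viaEF P Z → k ≤ viaFE P Z → k ≤ dist′ P Z
  ≤dist′ P Z h₁ h₂ h₃ = ⊓-glb (⊓-glb h₁ h₂) h₃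

  ≤suc-dist′ : ∀ P Z {k} → k ≤ suc (manhattan P Z) → k ≤ suc (viaEF P Z) → k ≤ suc (viaFE P Z) →
               k ≤ suc (dist′ P Z)
  ≤suc-dist′ P Z h₁ h₂ h₃ = ⊓-glb (⊓-glb h₁ h₂) h₃

  dist′-step : ∀ P Q Z → manhattan P Q ≤ 1 → dist′ P Z ≤ suc (dist′ Q Z)
  dist′-step P Q Z PQ≤1 = ≤suc-dist′ Q Z
    (≤-trans (dist′≤manhattan P Z) (detour (manhattan-triangle P Q Z)))
    (≤-trans (dist′≤viaEF P Z) (s≤s (+-monoˡ-≤ (manhattan F Z) (detour (manhattan-triangle P Q E)))))
    (≤-trans (dist′≤viaFE P Z) (s≤s (+-monoˡ-≤ (manhattan E Z) (detour (manhattan-triangle P Q F)))))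
    where
    detour : ∀ {k l} → k ≤ manhattan P Q + l → k ≤ suc l
    detour h = ≤-trans h (+-monoˡ-≤ _ PQ≤1)

  dist′-E : ∀ Z → dist′ E Z ≤ suc (manhattan F Z)
  dist′-E Z = ≤-trans (dist′≤viaEF E Z) (≤-reflexive (cong (λ k → suc (k + manhattan F Z)) (manhattan-self E)))

  dist′-F : ∀ Z → dist′ F Z ≤ suc (manhattan E Z)
  dist′-F Z = ≤-trans (dist′≤viaFE F Z) (≤-reflexive (cong (λ k → suc (k + manhattan E Z)) (manhattan-self F)))

  dist′-EF : ∀ Z → dist′ E Z ≤ suc (dist′ F Z)
  dist′-EF Z = ≤suc-dist′ F Z
    (dist′-E Z)
    (≤-trans (dist′-E Z) (s≤s (≤-trans (m≤n+m _ (manhattan F E)) (n≤1+n _))))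
    (≤-trans (dist′≤manhattan E Z) (≤-trans (m≤n+m _ (manhattan F F)) (≤-trans (n≤1+n _) (n≤1+n _))))

  dist′-FE : ∀ Z → dist′ F Z ≤ suc (dist′ E Z)
  dist′-FE Z = ≤suc-dist′ E Z
    (dist′-F Z)
    (≤-trans (dist′≤manhattan F Z) (≤-trans (m≤n+m _ (manhattan E E)) (≤-trans (n≤1+n _) (n≤1+n _))))
    (≤-trans (dist′-F Z) (s≤s (≤-trans (m≤n+m _ (manhattan E F)) (n≤1+n _))))

  dist′-adjacent : ∀ P Z → manhattan P Z ≡ 1 → dist′ P Z ≡ 1
  dist′-adjacent P Z e rewrite e = refl

  dist′-cong : ∀ A B Z → manhattan A Z ≡ manhattan B Z → manhattan A E ≡ manhattan B E →
               manhattan A F ≡ manhattan B F → dist′ A Z ≡ dist′ B Z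
  dist′-cong A B Z eZ eE eF rewrite eZ | eE | eF = refl

  dist′≡manhattan : ∀ P Z → manhattan P Z ≤ viaEF P Z → manhattan P Z ≤ viaFE P Z → dist′ P Z ≡ manhattan P Z
  dist′≡manhattan P Z h₂ h₃ = trans (cong (_⊓ viaFE P Z) (m≤n⇒m⊓n≡m h₂)) (m≤n⇒m⊓n≡m h₃)

  manhattan≤viaEF : ∀ P Z → manhattan P Z ≤ manhattan F Z → manhattan P Z ≤ viaEF P Z
  manhattan≤viaEF P Z h = ≤-trans h (≤-trans (m≤n+m _ (manhattan P E)) (n≤1+n _))

  dist′≡manhattan-if-flat : ∀ P Z →
    ∣ proj₁ E - proj₁ F ∣ + 2 * ∣ proj₂ P - proj₂ Z ∣ ≤ suc ∣ proj₂ E - proj₂ F ∣ → dist′ P Z ≡ manhattan P Z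
  dist′≡manhattan-if-flat P Z flat = dist′≡manhattan P Z (manhattan≤detour P E F Z flat)
    (manhattan≤detour P F E Z
      (subst₂ (λ h w → h + _ ≤ suc w) (∣-∣-comm (proj₁ E) (proj₁ F)) (∣-∣-comm (proj₂ E) (proj₂ F)) flat))

  dist′-agree-when-viaEF-idle : ∀ A B Z → manhattan A Z ≡ manhattan B Z → manhattan A F ≡ manhattan B F →
    manhattan A Z ≤ viaEF A Z → manhattan B Z ≤ viaEF B Z → dist′ A Z ≡ dist′ B Z
  dist′-agree-when-viaEF-idle A B Z eZ eF hA hB = begin
    dist′ A Z                         ≡⟨ cong (_⊓ viaFE A Z) (m≤n⇒m⊓n≡m hA) ⟩
    manhattan A Z ⊓ viaFE A Z          ≡⟨ cong₂ (λ k l → k ⊓ suc (l + manhattan E Z)) eZ eF ⟩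
    manhattan B Z ⊓ viaFE B Z          ≡⟨ cong (_⊓ viaFE B Z) (m≤n⇒m⊓n≡m hB) ⟨
    dist′ B Z ∎
    where open ≡-Reasoning

  dist′-next-to-E : ∀ P Z → manhattan P E ≡ 1 → dist′ P Z ≡ manhattan P Z ⊓ suc (suc (manhattan F Z))
  dist′-next-to-E P Z e = begin
    dist′ P Z                  ≡⟨ m≤n⇒m⊓n≡m (≤-trans (m⊓n≤m _ _) viaFE-idle) ⟩
    manhattan P Z ⊓ viaEF P Z  ≡⟨ cong (λ k → manhattan P Z ⊓ suc (k + manhattan F Z)) e ⟩
    manhattan P Z ⊓ suc (suc (manhattan F Z)) ∎
    where
    open ≡-Reasoning
    viaFE-idle : manhattan P Z ≤ viaFE P Z
    viaFE-idle = ≤-trans (manhattan-triangle P E Z)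
      (≤-trans (≤-reflexive (cong (_+ manhattan E Z) e)) (s≤s (m≤n+m _ (manhattan P F))))

  dist′-next-to-F : ∀ P Z → manhattan P F ≡ 1 → dist′ P Z ≡ manhattan P Z ⊓ suc (suc (manhattan E Z))
  dist′-next-to-F P Z e = begin
    dist′ P Z                  ≡⟨ cong (_⊓ viaFE P Z) (m≤n⇒m⊓n≡m viaEF-idle) ⟩
    manhattan P Z ⊓ viaFE P Z  ≡⟨ cong (λ k → manhattan P Z ⊓ suc (k + manhattan E Z)) e ⟩
    manhattan P Z ⊓ suc (suc (manhattan E Z)) ∎
    where
    open ≡-Reasoning
    viaEF-idle : manhattan P Z ≤ viaEF P Z
    viaEF-idle = ≤-trans (manhattan-triangle P F Z)
      (≤-trans (≤-reflexive (cong (_+ manhattan F Z) e)) (s≤s (m≤n+m _ (manhattan P E))))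

  Agree : Point → Point → Point → ℕ → Set
  Agree A B Z bound = manhattan A Z ≡ manhattan B Z ⊎ (bound ≤ manhattan A Z × bound ≤ manhattan B Z)

  E-neighbours-agree : ∀ A B Z → manhattan A E ≡ 1 → manhattan B E ≡ 1 →
    Agree A B Z (suc (suc (manhattan F Z))) → dist′ A Z ≡ dist′ B Z
  E-neighbours-agree A B Z eA eB h =
    trans (dist′-next-to-E A Z eA) (trans (⊓-agree h) (sym (dist′-next-to-E B Z eB)))

  F-neighbours-agree : ∀ A B Z → manhattan A F ≡ 1 → manhattan B F ≡ 1 →
    Agree A B Z (suc (suc (manhattan E Z))) → dist′ A Z ≡ dist′ B Z
  F-neighbours-agree A B Z eA eB h =
    trans (dist′-next-to-F A Z eA) (trans (⊓-agree h) (sym (dist′-next-to-F B Z eB)))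

near-values-collide : ∀ {k} w (v : Fin k → ℕ) → 3 < k → (∀ i → v i ≤ suc w) → (∀ i → w ≤ suc (v i)) →
                      ∃₂ λ i j → i Fin.< j × v i ≡ v j
near-values-collide w v 3<k v≤1+w w≤1+v with pigeonhole 3<k offset
  where
  offset : _ → Fin 3
  offset i = fromℕ< (s≤s (m≤n+o⇒m∸n≤o (suc (v i)) w (≤-trans (s≤s (v≤1+w i)) (≤-reflexive (+-comm 2 w)))))
... | i , j , i<j , same-offset = i , j , i<j , suc-injective
  (∸-cancelʳ-≡ (w≤1+v i) (w≤1+v j) (trans (sym (toℕ-fromℕ< _)) (trans (cong toℕ same-offset) (toℕ-fromℕ< _))))

module Unresolvedness (n m : ℕ) (E F : Point) where
  open Shortcut E F

  InGrid : Point → Set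
  InGrid (x , y) = 1 ≤ x × x ≤ n × 1 ≤ y × y ≤ m

  record Unresolved (X Y : Point) : Set where
    constructor unresolved
    field
      A B : Point
      A∈grid : InGrid A
      B∈grid : InGrid B
      A≢B : A ≢ B
      agree-X : dist′ A X ≡ dist′ B X
      agree-Y : dist′ A Y ≡ dist′ B Y

  Unresolved-sym : ∀ {X Y} → Unresolved X Y → Unresolved Y X
  Unresolved-sym (unresolved A B A∈ B∈ A≢B eX eY) = unresolved A B A∈ B∈ A≢B eY eX

  antidiagonal-pair : ∀ {X Y p q} → 1 ≤ p → p < n → 1 ≤ q → q < m →
    dist′ (suc p , q) X ≡ dist′ (p , suc q) X → dist′ (suc p , q) Y ≡ dist′ (p , suc q) Y → Unresolved X Y
  antidiagonal-pair 1≤p p<n 1≤q q<m =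
    unresolved _ _ (s≤s z≤n , p<n , 1≤q , <⇒≤ q<m) (1≤p , <⇒≤ p<n , s≤s z≤n , q<m) (λ e → 1+n≢n (cong proj₁ e))

  diagonal-pair : ∀ {X Y p q} → 1 ≤ p → p < n → 1 ≤ q → q < m →
    dist′ (p , q) X ≡ dist′ (suc p , suc q) X → dist′ (p , q) Y ≡ dist′ (suc p , suc q) Y → Unresolved X Y
  diagonal-pair 1≤p p<n 1≤q q<m =
    unresolved _ _ (1≤p , <⇒≤ p<n , 1≤q , <⇒≤ q<m) (s≤s z≤n , p<n , s≤s z≤n , q<m)
      (λ e → 1+n≢n (sym (cong proj₁ e)))

  comparable-cell : ∀ {X Y p q} → 1 ≤ p → p < n → 1 ≤ q → q < m →
    Comparable p q E → Comparable p q F → Comparable p q X → Comparable p q Y → Unresolved X Y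
  comparable-cell {X} {Y} {p} {q} 1≤p p<n 1≤q q<m cE cF cX cY =
    antidiagonal-pair 1≤p p<n 1≤q q<m (agree X cX) (agree Y cY)
    where
    agree : ∀ Z → Comparable p q Z → dist′ (suc p , q) Z ≡ dist′ (p , suc q) Z
    agree Z cZ = dist′-cong (suc p , q) (p , suc q) Z
      (antidiagonal-equidistant Z cZ) (antidiagonal-equidistant E cE) (antidiagonal-equidistant F cF)

  incomparable-cell : ∀ {X Y p q} → 1 ≤ p → p < n → 1 ≤ q → q < m →
    Incomparable p q E → Incomparable p q F → Incomparable p q X → Incomparable p q Y → Unresolved X Y
  incomparable-cell {X} {Y} {p} {q} 1≤p p<n 1≤q q<m iE iF iX iY =
    diagonal-pair 1≤p p<n 1≤q q<m (agree X iX) (agree Y iY)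
    where
    agree : ∀ Z → Incomparable p q Z → dist′ (p , q) Z ≡ dist′ (suc p , suc q) Z
    agree Z iZ = dist′-cong (p , q) (suc p , suc q) Z
      (diagonal-equidistant Z iZ) (diagonal-equidistant E iE) (diagonal-equidistant F iF)

  -- The four grid neighbours of (x + 1 , y + 1).
  neighbour : ℕ → ℕ → Fin 4 → Point
  neighbour x y zero = x , suc y
  neighbour x y (suc zero) = suc (suc x) , suc y
  neighbour x y (suc (suc zero)) = suc x , y
  neighbour x y (suc (suc (suc zero))) = suc x , suc (suc y)

  neighbour-adjacent : ∀ x y i → manhattan (neighbour x y i) (suc x , suc y) ≡ 1
  neighbour-adjacent x y zero rewrite ∣n-1+n∣≡1 x | ∣n-n∣≡0 y = refl
  neighbour-adjacent x y (suc zero) rewrite ∣-∣-comm (suc x) x | ∣n-1+n∣≡1 x | ∣n-n∣≡0 y = refl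
  neighbour-adjacent x y (suc (suc zero)) rewrite ∣n-n∣≡0 x | ∣n-1+n∣≡1 y = refl
  neighbour-adjacent x y (suc (suc (suc zero))) rewrite ∣n-n∣≡0 x | ∣-∣-comm (suc y) y | ∣n-1+n∣≡1 y = refl

  neighbour-injective : ∀ x y {i j} → neighbour x y i ≡ neighbour x y j → i ≡ j
  neighbour-injective x y {zero} {zero} _ = refl
  neighbour-injective x y {suc zero} {suc zero} _ = refl
  neighbour-injective x y {suc (suc zero)} {suc (suc zero)} _ = refl
  neighbour-injective x y {suc (suc (suc zero))} {suc (suc (suc zero))} _ = refl
  neighbour-injective x y {zero} {suc zero} ()
  neighbour-injective x y {zero} {suc (suc zero)} ()
  neighbour-injective x y {zero} {suc (suc (suc zero))} ()
  neighbour-injective x y {suc zero} {zero} ()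
  neighbour-injective x y {suc zero} {suc (suc zero)} ()
  neighbour-injective x y {suc zero} {suc (suc (suc zero))} ()
  neighbour-injective x y {suc (suc zero)} {zero} ()
  neighbour-injective x y {suc (suc zero)} {suc zero} ()
  neighbour-injective x y {suc (suc zero)} {suc (suc (suc zero))} ()
  neighbour-injective x y {suc (suc (suc zero))} {zero} ()
  neighbour-injective x y {suc (suc (suc zero))} {suc zero} ()
  neighbour-injective x y {suc (suc (suc zero))} {suc (suc zero)} ()

  neighbour-in-grid : ∀ {x y} → 1 ≤ x → 2 + x ≤ n → 1 ≤ y → 2 + y ≤ m → ∀ i → InGrid (neighbour x y i)
  neighbour-in-grid 1≤x x<n 1≤y y<m zero = 1≤x , ≤-trans (n≤1+n _) (<⇒≤ x<n) , s≤s z≤n , <⇒≤ y<m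
  neighbour-in-grid 1≤x x<n 1≤y y<m (suc zero) = s≤s z≤n , x<n , s≤s z≤n , <⇒≤ y<m
  neighbour-in-grid 1≤x x<n 1≤y y<m (suc (suc zero)) = s≤s z≤n , <⇒≤ x<n , 1≤y , ≤-trans (n≤1+n _) (<⇒≤ y<m)
  neighbour-in-grid 1≤x x<n 1≤y y<m (suc (suc (suc zero))) = s≤s z≤n , <⇒≤ x<n , s≤s z≤n , y<m

  interior-unresolved : ∀ {x y} Y → 1 ≤ x → 2 + x ≤ n → 1 ≤ y → 2 + y ≤ m → Unresolved (suc x , suc y) Y
  interior-unresolved {x} {y} Y 1≤x x<n 1≤y y<m = from-collision collision
    where
    X : Point
    X = suc x , suc y
    distance-to-Y : Fin 4 → ℕ
    distance-to-Y i = dist′ (neighbour x y i) Y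
    collision : ∃₂ λ i j → i Fin.< j × distance-to-Y i ≡ distance-to-Y j
    collision = near-values-collide (dist′ X Y) distance-to-Y (s≤s (s≤s (s≤s (s≤s z≤n))))
      (λ i → dist′-step (neighbour x y i) X Y (≤-reflexive (neighbour-adjacent x y i)))
      (λ i → dist′-step X (neighbour x y i) Y
               (≤-reflexive (trans (manhattan-sym X (neighbour x y i)) (neighbour-adjacent x y i))))
    from-collision : (∃₂ λ i j → i Fin.< j × distance-to-Y i ≡ distance-to-Y j) → Unresolved X Y
    from-collision (i , j , i<j , agree-Y) =
      unresolved _ _ (neighbour-in-grid 1≤x x<n 1≤y y<m i) (neighbour-in-grid 1≤x x<n 1≤y y<m j)
        (Finₚ.<⇒≢ i<j ∘ neighbour-injective x y)
        (trans (dist′-adjacent (neighbour x y i) X (neighbour-adjacent x y i))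
               (sym (dist′-adjacent (neighbour x y j) X (neighbour-adjacent x y j))))
        agree-Y

top-left-gap : ∀ {a′ b c d m} → 1 ≤ c → c ≤ a′ → b + 2 ≤ d → d ≤ m →
  2 + manhattan (c , d) (1 , m) ≤ manhattan (a′ , b) (1 , m)
top-left-gap {b = b} {c = suc c₀} (s≤s z≤n) c≤a′ b+2≤d d≤m
  with k , refl ← m≤n⇒∃[o]m+o≡n c≤a′ | r , refl ← m≤n⇒∃[o]m+o≡n b+2≤d | t , refl ← m≤n⇒∃[o]m+o≡n d≤m
  rewrite ∣-∣-identityʳ c₀ | ∣m-n∣≡k {b + 2 + r} t refl | ∣-∣-identityʳ (c₀ + k)
        | ∣m-n∣≡k {b} {b + 2 + r + t} (2 + r + t) (solve (b ∷ r ∷ t ∷ []))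
  = ≤-by (k + r) (solve (c₀ ∷ t ∷ k ∷ r ∷ []))

bottom-gap-left : ∀ {a b c′ d x} → x ≤ c′ → c′ ≤ a → 1 ≤ b → a + b + 3 ≤ suc c′ + d →
  2 + manhattan (a , b) (x , 1) ≤ manhattan (c′ , d) (x , 1)
bottom-gap-left {b = suc b₀} {d = d} {x = x} x≤c′ c′≤a (s≤s z≤n) gain
  with t , refl ← m≤n⇒∃[o]m+o≡n x≤c′ | k , refl ← m≤n⇒∃[o]m+o≡n c′≤a | s , e ← m≤n⇒∃[o]m+o≡n gain
  with refl ← cancel-offset (suc (x + t)) _ s e (k + b₀ + 3 + s) (solve (x ∷ t ∷ k ∷ b₀ ∷ s ∷ []))
  rewrite ∣n-m∣≡k {x} {x + t + k} (t + k) (solve (x ∷ t ∷ k ∷ [])) | ∣-∣-identityʳ b₀ | ∣n-m∣≡k {x} t refl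
        | ∣n-m∣≡k {1} {k + b₀ + 3 + s} (k + b₀ + 2 + s) (solve (k ∷ b₀ ∷ s ∷ []))
  = ≤-by s (solve (t ∷ k ∷ b₀ ∷ s ∷ []))

bottom-gap-right : ∀ {a b c d′ x} → c ≤ x → c ≤ a → 1 ≤ b → a + b + 3 ≤ c + suc d′ →
  2 + manhattan (a , b) (x , 1) ≤ manhattan (c , d′) (x , 1)
bottom-gap-right {a} {suc b₀} {c} {d′} {x} c≤x c≤a (s≤s z≤n) gain with ≤-total x a
... | inj₁ x≤a
  with t , refl ← m≤n⇒∃[o]m+o≡n c≤x | u , refl ← m≤n⇒∃[o]m+o≡n x≤a | s , e ← m≤n⇒∃[o]m+o≡n gain
  with refl ← cancel-offset c _ s e (suc (t + u + b₀ + 3 + s)) (solve (c ∷ t ∷ u ∷ b₀ ∷ s ∷ []))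
  rewrite ∣n-m∣≡k {c + t} u refl | ∣-∣-identityʳ b₀ | ∣m-n∣≡k {c} t refl
        | ∣n-m∣≡k {1} {t + u + b₀ + 3 + s} (t + u + b₀ + 2 + s) (solve (t ∷ u ∷ b₀ ∷ s ∷ []))
  = ≤-by (t + t + s) (solve (t ∷ u ∷ b₀ ∷ s ∷ []))
... | inj₂ a≤x
  with k , refl ← m≤n⇒∃[o]m+o≡n c≤a | u , refl ← m≤n⇒∃[o]m+o≡n a≤x | s , e ← m≤n⇒∃[o]m+o≡n gain
  with refl ← cancel-offset c _ s e (suc (k + b₀ + 3 + s)) (solve (c ∷ k ∷ b₀ ∷ s ∷ []))
  rewrite ∣m-n∣≡k {c + k} u refl | ∣-∣-identityʳ b₀ | ∣m-n∣≡k {c} {c + k + u} (k + u) (solve (c ∷ k ∷ u ∷ []))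
        | ∣n-m∣≡k {1} {k + b₀ + 3 + s} (k + b₀ + 2 + s) (solve (k ∷ b₀ ∷ s ∷ []))
  = ≤-by (k + k + s) (solve (k ∷ u ∷ b₀ ∷ s ∷ []))

steep-edge : ∀ {a b c d} → c ≤ a → b ≤ d → a + b + 1 ≤ c + d → ∣ a - c ∣ + 2 ≤ suc ∣ b - d ∣
steep-edge {b = b} {c} c≤a b≤d gain
  with k , refl ← m≤n⇒∃[o]m+o≡n c≤a | r , refl ← m≤n⇒∃[o]m+o≡n b≤d | s , e ← m≤n⇒∃[o]m+o≡n gain
  with refl ← cancel-offset (c + b) {r} _ s (trans e (solve (c ∷ b ∷ r ∷ [])))
                 (k + 1 + s) (solve (c ∷ k ∷ b ∷ s ∷ []))
  rewrite ∣n-m∣≡k {c} k refl | ∣m-n∣≡k {b} (k + 1 + s) refl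
  = ≤-by s (solve (k ∷ s ∷ []))

2≤n∸1⇒3≤n : ∀ {n} → 2 ≤ n ∸ 1 → 3 ≤ n
2≤n∸1⇒3≤n {suc n} h = s≤s h

gain-from-Gain′ : ∀ {a b c d} → c ≤ a → b ≤ d → a ∸ c ≤ d ∸ b → 2 ≤ ∣ ∣ d - b ∣ - ∣ a - c ∣ ∣ ∸ 1 →
  a + b + 3 ≤ c + d
gain-from-Gain′ {b = b} {c} c≤a b≤d slopes Gain′
  with p , refl ← m≤n⇒∃[o]m+o≡n c≤a | q , refl ← m≤n⇒∃[o]m+o≡n b≤d
  rewrite ∣n-m∣≡k {b} q refl | ∣n-m∣≡k {c} p refl | m+n∸m≡n c p | m+n∸m≡n b q
  with r , refl ← m≤n⇒∃[o]m+o≡n slopes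
  rewrite ∣n-m∣≡k {p} r refl
  with r₀ , refl ← m≤n⇒∃[o]m+o≡n (2≤n∸1⇒3≤n {r} Gain′)
  = ≤-by r₀ (solve (c ∷ p ∷ b ∷ r₀ ∷ []))

data Range (k′ : ℕ) : ℕ → Set where
  first : Range k′ 1
  inner : ∀ {z} → 2 ≤ z → z ≤ k′ → Range k′ z
  last : Range k′ (suc k′)

range : ∀ {k′ z} → 1 ≤ z → z ≤ suc k′ → Range k′ z
range {k′} {z} 1≤z z≤1+k′ with z ≟ 1 | z ≤? k′
... | yes refl | _ = first
... | no z≢1 | yes z≤k′ = inner (≤∧≢⇒< 1≤z (z≢1 ∘ sym)) z≤k′
... | no _ | no z≰k′ with refl ← ≤-antisym z≤1+k′ (≰⇒> z≰k′) = last

module Configuration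
  (n′ m′ a′ b′ c′ d′ : ℕ) (1≤c′ : 1 ≤ c′) (c<a : suc c′ < suc a′) (a<n : suc a′ < suc n′)
  (1≤b′ : 1 ≤ b′) (d<m : suc d′ < suc m′) (gain : suc a′ + suc b′ + 3 ≤ suc c′ + suc d′) where

  -- Coordinates are given by their predecessors, so that the neighbours (a′ , b) and (a , b′)
  -- of E, and those of F, are written without truncated subtraction.

  n m a b c d : ℕ
  n = suc n′
  m = suc m′
  a = suc a′
  b = suc b′
  c = suc c′
  d = suc d′

  E F : Point
  E = a , b
  F = c , d

  open Shortcut E F
  open Unresolvedness n m E F

  c≤a : c ≤ a
  c≤a = <⇒≤ c<a
  c≤a′ : c ≤ a′
  c≤a′ = ≤-pred c<a
  a≤n′ : a ≤ n′
  a≤n′ = ≤-pred a<n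
  c≤n′ : c ≤ n′
  c≤n′ = ≤-trans c≤a a≤n′
  d≤m′ : d ≤ m′
  d≤m′ = ≤-pred d<m
  2≤c : 2 ≤ c
  2≤c = s≤s 1≤c′
  2≤a : 2 ≤ a
  2≤a = ≤-trans 2≤c c≤a
  2≤b : 2 ≤ b
  2≤b = s≤s 1≤b′
  1≤a′ : 1 ≤ a′
  1≤a′ = ≤-trans (s≤s z≤n) c≤a′
  b+3≤d : b + 3 ≤ d
  b+3≤d = +-cancelˡ-≤ c _ _ (≤-trans (+-monoˡ-≤ (b + 3) c≤a) (≤-trans (≤-reflexive (sym (+-assoc a b 3))) gain))
  b<d : b < d
  b<d = ≤-trans (≤-trans (m≤m+n (suc b) 2) (≤-reflexive (sym (+-suc b 2)))) b+3≤d
  b≤m′ : b ≤ m′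
  b≤m′ = ≤-trans (<⇒≤ b<d) d≤m′
  2≤d : 2 ≤ d
  2≤d = ≤-trans 2≤b (<⇒≤ b<d)
  1≤a : 1 ≤ a
  1≤a = <⇒≤ 2≤a
  1≤c : 1 ≤ c
  1≤c = <⇒≤ 2≤c
  1≤d : 1 ≤ d
  1≤d = <⇒≤ 2≤d
  1≤d′ : 1 ≤ d′
  1≤d′ = ≤-pred 2≤d
  1≤n′ : 1 ≤ n′
  1≤n′ = ≤-trans 1≤a a≤n′
  1≤m′ : 1 ≤ m′
  1≤m′ = ≤-trans 1≤d d≤m′
  2≤n : 2 ≤ n
  2≤n = s≤s 1≤n′
  2≤m : 2 ≤ m
  2≤m = s≤s 1≤m′

  dist′≡manhattan-if-level : ∀ P Z → ∣ proj₂ P - proj₂ Z ∣ ≤ 1 → dist′ P Z ≡ manhattan P Z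
  dist′≡manhattan-if-level P Z level = dist′≡manhattan-if-flat P Z
    (≤-trans (+-monoʳ-≤ ∣ a - c ∣ (*-monoʳ-≤ 2 level))
      (steep-edge c≤a (<⇒≤ b<d) (≤-trans (+-monoʳ-≤ (a + b) (s≤s z≤n)) gain)))

  -- The cells at the four corners of the grid; every point outside the last row and
  -- column, for instance, is comparable with the north-east cell.
  NE SW SE NW : Point → Set
  NE = Comparable n′ m′
  SW = Comparable 1 1
  SE = Incomparable n′ 1
  NW = Incomparable 1 m′

  NE-unresolved : ∀ {X Y} → NE X → NE Y → Unresolved X Y
  NE-unresolved = comparable-cell 1≤n′ ≤-refl 1≤m′ ≤-refl (inj₁ (a≤n′ , b≤m′)) (inj₁ (c≤n′ , d≤m′))

  SW-unresolved : ∀ {X Y} → SW X → SW Y → Unresolved X Y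
  SW-unresolved = comparable-cell ≤-refl 2≤n ≤-refl 2≤m (inj₂ (2≤a , 2≤b)) (inj₂ (2≤c , 2≤d))

  SE-unresolved : ∀ {X Y} → SE X → SE Y → Unresolved X Y
  SE-unresolved = incomparable-cell 1≤n′ ≤-refl ≤-refl 2≤m (inj₁ (a≤n′ , 2≤b)) (inj₁ (c≤n′ , 2≤d))

  NW-unresolved : ∀ {X Y} → NW X → NW Y → Unresolved X Y
  NW-unresolved = incomparable-cell ≤-refl 2≤n 1≤m′ ≤-refl (inj₂ (2≤a , b≤m′)) (inj₂ (2≤c , d≤m′))

  E-pair : ∀ {X Y} → dist′ (a , b′) X ≡ dist′ (a′ , b) X → dist′ (a , b′) Y ≡ dist′ (a′ , b) Y → Unresolved X Y
  E-pair = antidiagonal-pair 1≤a′ (<⇒≤ a<n) 1≤b′ (m≤n⇒m≤1+n b≤m′)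

  E-pair-agrees : ∀ Z → Agree (a , b′) (a′ , b) Z (2 + manhattan F Z) → dist′ (a , b′) Z ≡ dist′ (a′ , b) Z
  E-pair-agrees Z = E-neighbours-agree (a , b′) (a′ , b) Z
    (proj₁ (antidiagonal-next-to-corner a′ b′)) (proj₂ (antidiagonal-next-to-corner a′ b′))

  E-pair-agrees-top-left : dist′ (a , b′) (1 , m) ≡ dist′ (a′ , b) (1 , m)
  E-pair-agrees-top-left =
    E-pair-agrees (1 , m) (inj₂ (≤-trans (≤-trans gap (m≤n+m _ 2)) (≤-reflexive (sym far)) , gap))
    where
    gap : 2 + manhattan F (1 , m) ≤ manhattan (a′ , b) (1 , m)
    gap = top-left-gap {a′} {b} {c} {d} {m} 1≤c c≤a′ (≤-trans (+-monoʳ-≤ b (n≤1+n 2)) b+3≤d) (m≤n⇒m≤1+n d≤m′)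
    far : manhattan (a , b′) (1 , m) ≡ 2 + manhattan (a′ , b) (1 , m)
    far = antidiagonal-gap-above-left 1≤a′ (m≤n⇒m≤1+n b≤m′)

  F-pair : ∀ {X Y} → dist′ (c , d′) X ≡ dist′ (c′ , d) X → dist′ (c , d′) Y ≡ dist′ (c′ , d) Y → Unresolved X Y
  F-pair = antidiagonal-pair 1≤c′ (m≤n⇒m≤1+n c≤n′) 1≤d′ (m≤n⇒m≤1+n d≤m′)

  F-pair-agrees : ∀ Z → Agree (c , d′) (c′ , d) Z (2 + manhattan E Z) → dist′ (c , d′) Z ≡ dist′ (c′ , d) Z
  F-pair-agrees Z = F-neighbours-agree (c , d′) (c′ , d) Z
    (proj₁ (antidiagonal-next-to-corner c′ d′)) (proj₂ (antidiagonal-next-to-corner c′ d′))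

  F-pair-agrees-bottom : ∀ x → dist′ (c , d′) (x , 1) ≡ dist′ (c′ , d) (x , 1)
  F-pair-agrees-bottom x with x ≤? c′
  ... | yes x≤c′ = F-pair-agrees (x , 1) (inj₁ (antidiagonal-equidistant (x , 1) (inj₁ (x≤c′ , 1≤d′))))
  ... | no x≰c′ = F-pair-agrees (x , 1) (inj₂ (gap , ≤-trans (≤-trans gap (m≤n+m _ 2)) (≤-reflexive (sym far))))
    where
    gap : 2 + manhattan E (x , 1) ≤ manhattan (c , d′) (x , 1)
    gap = bottom-gap-right {a} {b} {c} {d′} {x} (≰⇒> x≰c′) c≤a (s≤s z≤n) gain
    far : manhattan (c′ , d) (x , 1) ≡ 2 + manhattan (c , d′) (x , 1)
    far = antidiagonal-gap-below-right (≰⇒> x≰c′) 1≤d′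

  corner-pair : ∀ {X Y} → X ≡ (1 , 1) ⊎ X ≡ (n , m) → Y ≡ (1 , m) ⊎ Y ≡ (n , 1) → Unresolved X Y
  corner-pair (inj₁ refl) (inj₁ refl) =
    E-pair (E-pair-agrees (1 , 1) (inj₁ (antidiagonal-equidistant (1 , 1) (inj₁ (1≤a′ , 1≤b′)))))
      E-pair-agrees-top-left
  corner-pair (inj₁ refl) (inj₂ refl) = F-pair (F-pair-agrees-bottom 1) (F-pair-agrees-bottom n)
  corner-pair (inj₂ refl) (inj₁ refl) =
    E-pair (E-pair-agrees (n , m) (inj₁ (antidiagonal-equidistant (n , m) (inj₂ (<⇒≤ a<n , m≤n⇒m≤1+n b≤m′)))))
      E-pair-agrees-top-left
  corner-pair (inj₂ refl) (inj₂ refl) =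
    F-pair (F-pair-agrees (n , m) (inj₁ (antidiagonal-equidistant (n , m) (inj₂ (m≤n⇒m≤1+n c≤n′ , <⇒≤ d<m)))))
      (F-pair-agrees-bottom n)

  below-F-column : ∀ {x} → x < c → Unresolved (x , 1) (x , m)
  below-F-column {x} x<c = diagonal-pair 1≤c′ (m≤n⇒m≤1+n c≤n′) 1≤d d<m agree-bottom agree-top
    where
    x≤c′ : x ≤ c′
    x≤c′ = ≤-pred x<c
    agree : ∀ Z → Agree (c′ , d) (c , suc d) Z (2 + manhattan E Z) → dist′ (c′ , d) Z ≡ dist′ (c , suc d) Z
    agree Z = F-neighbours-agree (c′ , d) (c , suc d) Z
      (proj₁ (diagonal-next-to-corner c′ d)) (proj₂ (diagonal-next-to-corner c′ d))
    gap : 2 + manhattan E (x , 1) ≤ manhattan (c′ , d) (x , 1)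
    gap = bottom-gap-left {a} {b} {c′} {d} {x} x≤c′ (≤-trans (n≤1+n c′) c≤a) (s≤s z≤n) gain
    agree-bottom : dist′ (c′ , d) (x , 1) ≡ dist′ (c , suc d) (x , 1)
    agree-bottom = agree (x , 1)
      (inj₂ (gap , ≤-trans (≤-trans gap (m≤n+m _ 2)) (≤-reflexive (sym (diagonal-gap-below-left x≤c′ 1≤d)))))
    agree-top : dist′ (c′ , d) (x , m) ≡ dist′ (c , suc d) (x , m)
    agree-top = agree (x , m) (inj₁ (diagonal-equidistant (x , m) (inj₁ (x≤c′ , d<m))))

  south-north : ∀ {x u} → 2 ≤ x → x ≤ n′ → 2 ≤ u → u ≤ n′ → Unresolved (x , 1) (u , m)
  south-north {x} {u} 2≤x x≤n′ 2≤u u≤n′ with c ≤? u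
  ... | yes c≤u = F-pair (F-pair-agrees-bottom x)
    (F-pair-agrees (u , m) (inj₁ (antidiagonal-equidistant (u , m) (inj₂ (c≤u , <⇒≤ d<m)))))
  ... | no c≰u with <-cmp u x
  ...   | tri< u<x _ _ = incomparable-cell (<⇒≤ 2≤u) (s≤s u≤n′) 1≤d d<m
    (inj₂ (≤-trans u<c c≤a , <⇒≤ b<d)) (inj₂ (u<c , ≤-refl))
    (inj₂ (u<x , 1≤d)) (inj₁ (≤-refl , d<m))
    where
    u<c : u < c
    u<c = ≰⇒> c≰u
  ...   | tri≈ _ refl _ = below-F-column (≰⇒> c≰u)
  ...   | tri> _ _ x<u = comparable-cell (<⇒≤ 2≤x) (s≤s x≤n′) ≤-refl 2≤m
    (inj₂ (≤-trans x<c c≤a , 2≤b)) (inj₂ (x<c , 2≤d)) (inj₁ (≤-refl , ≤-refl)) (inj₂ (x<u , 2≤m))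
    where
    x<c : x < c
    x<c = <-trans x<u (≰⇒> c≰u)

  west-east-row : ∀ {y₀} → 1 ≤ y₀ → suc y₀ ≤ m′ → Unresolved (1 , suc y₀) (n , suc y₀)
  west-east-row {y₀} 1≤y₀ y<m′ =
    unresolved (1 , y₀) (1 , suc (suc y₀)) (≤-refl , 1≤n , 1≤y₀ , m≤n⇒m≤1+n (<⇒≤ y<m′))
      (≤-refl , 1≤n , s≤s z≤n , s≤s y<m′) (λ ())
      (trans (dist′-adjacent (1 , y₀) X below) (sym (dist′-adjacent (1 , suc (suc y₀)) X above)))
      (begin
        dist′ (1 , y₀) Y                ≡⟨ dist′≡manhattan-if-level (1 , y₀) Y (≤-reflexive below) ⟩
        ∣ 1 - n ∣ + ∣ y₀ - suc y₀ ∣          ≡⟨ cong (∣ 1 - n ∣ +_) (trans below (sym above)) ⟩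
        ∣ 1 - n ∣ + ∣ suc y₀ - y₀ ∣          ≡⟨ dist′≡manhattan-if-level (1 , suc (suc y₀)) Y (≤-reflexive above) ⟨
        dist′ (1 , suc (suc y₀)) Y ∎)
    where
    open ≡-Reasoning
    X Y : Point
    X = 1 , suc y₀
    Y = n , suc y₀
    1≤n : 1 ≤ n
    1≤n = s≤s z≤n
    below : ∣ y₀ - suc y₀ ∣ ≡ 1
    below = ∣n-1+n∣≡1 y₀
    above : ∣ suc y₀ - y₀ ∣ ≡ 1
    above = trans (∣-∣-comm (suc y₀) y₀) (∣n-1+n∣≡1 y₀)

  west-east-strip : ∀ {y u} → 2 ≤ y → y < u → u ≤ d → Unresolved (1 , y) (n , u)
  west-east-strip {y} {suc q} 2≤y (s≤s y≤q) q<d =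
    antidiagonal-pair ≤-refl 2≤n (≤-trans (<⇒≤ 2≤y) y≤q) (s≤s (≤-trans (<⇒≤ q<d) d≤m′))
      agree-X agree-Y
    where
    X Y : Point
    X = 1 , y
    Y = n , suc q
    same-to-F : manhattan (2 , q) F ≡ manhattan (1 , suc q) F
    same-to-F = antidiagonal-equidistant F (inj₂ (2≤c , q<d))
    same-to-X : manhattan (2 , q) X ≡ manhattan (1 , suc q) X
    same-to-X = antidiagonal-equidistant X (inj₁ (≤-refl , y≤q))
    closer-than-F : manhattan (1 , suc q) X ≤ manhattan F X
    closer-than-F = ≤-trans (∣-∣-monoˡ-≤ (≤-trans y≤q (n≤1+n q)) q<d) (m≤n+m _ ∣ c - 1 ∣)
    agree-X : dist′ (2 , q) X ≡ dist′ (1 , suc q) X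
    agree-X = dist′-agree-when-viaEF-idle (2 , q) (1 , suc q) X same-to-X same-to-F
      (manhattan≤viaEF (2 , q) X (≤-trans (≤-reflexive same-to-X) closer-than-F))
      (manhattan≤viaEF (1 , suc q) X closer-than-F)
    agree-Y : dist′ (2 , q) Y ≡ dist′ (1 , suc q) Y
    agree-Y = trans (dist′≡manhattan-if-level (2 , q) Y (≤-reflexive (∣n-1+n∣≡1 q)))
      (trans (antidiagonal-equidistant Y (inj₂ (2≤n , ≤-refl)))
        (sym (dist′≡manhattan-if-level (1 , suc q) Y (≤-trans (≤-reflexive (∣n-n∣≡0 q)) z≤n))))

  west-east : ∀ {y u} → 2 ≤ y → y ≤ m′ → 2 ≤ u → u ≤ m′ → Unresolved (1 , y) (n , u)
  west-east {y} {u} 2≤y y≤m′ 2≤u u≤m′ with <-cmp u y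
  ... | tri< u<y _ _ = descending
    where
    cell : ∀ {p} → 1 ≤ p → p < n → Incomparable p u E → Incomparable p u F → Unresolved (1 , y) (n , u)
    cell 1≤p p<n iE iF =
      incomparable-cell 1≤p p<n (<⇒≤ 2≤u) (s≤s u≤m′) iE iF (inj₁ (1≤p , u<y)) (inj₂ (p<n , ≤-refl))
    descending : Unresolved (1 , y) (n , u)
    descending with u <? b | u <? d
    ... | yes u<b | _ = cell 1≤a a<n (inj₁ (≤-refl , u<b)) (inj₁ (c≤a , <-trans u<b b<d))
    ... | no u≮b | yes u<d = cell 1≤c (<-trans c<a a<n) (inj₂ (c<a , ≮⇒≥ u≮b)) (inj₁ (≤-refl , u<d))
    ... | no u≮b | no u≮d = cell ≤-refl 2≤n (inj₂ (2≤a , ≮⇒≥ u≮b)) (inj₂ (2≤c , ≮⇒≥ u≮d))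
  ... | tri≈ _ refl _ with 2≤y
  ...   | s≤s 1≤y₀ = west-east-row 1≤y₀ y≤m′
  west-east {y} {u} 2≤y y≤m′ 2≤u u≤m′ | tri> _ _ y<u = ascending
    where
    cell : ∀ {p q} → 1 ≤ p → p < n → 1 ≤ q → q < m → y ≤ q → q < u →
           Comparable p q E → Comparable p q F → Unresolved (1 , y) (n , u)
    cell 1≤p p<n 1≤q q<m y≤q q<u cE cF =
      comparable-cell 1≤p p<n 1≤q q<m cE cF (inj₁ (1≤p , y≤q)) (inj₂ (p<n , q<u))
    1≤y : 1 ≤ y
    1≤y = <⇒≤ 2≤y
    beyond-F : b ≤ y → d < u → Unresolved (1 , y) (n , u)
    beyond-F b≤y d<u with ≤-total y d
    ... | inj₁ y≤d = cell 1≤a a<n 1≤d d<m y≤d d<u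
                       (inj₁ (≤-refl , <⇒≤ b<d)) (inj₁ (c≤a , ≤-refl))
    ... | inj₂ d≤y = cell 1≤a a<n 1≤y (s≤s y≤m′) ≤-refl y<u
                       (inj₁ (≤-refl , b≤y)) (inj₁ (c≤a , d≤y))
    ascending : Unresolved (1 , y) (n , u)
    ascending with y <? b | d <? u
    ... | yes y<b | _ = cell ≤-refl 2≤n 1≤y (s≤s y≤m′) ≤-refl y<u (inj₂ (2≤a , y<b)) (inj₂ (2≤c , <-trans y<b b<d))
    ... | no y≮b | yes d<u = beyond-F (≮⇒≥ y≮b) d<u
    ... | no y≮b | no d≮u = west-east-strip 2≤y y<u (≮⇒≥ d≮u)

  -- Each boundary point lies in two of the four corner regions; two boundary points share
  -- a region unless their classes are opposite, which leaves the pairs of opposite corners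
  -- and the pairs of points on opposite sides.
  data OnBoundary (X : Point) : Set where
    diagonal-corner : NE X → SW X → X ≡ (1 , 1) ⊎ X ≡ (n , m) → OnBoundary X
    antidiagonal-corner : SE X → NW X → X ≡ (1 , m) ⊎ X ≡ (n , 1) → OnBoundary X
    west-side : NE X → SE X → ∃ (λ y → X ≡ (1 , y) × 2 ≤ y × y ≤ m′) → OnBoundary X
    east-side : SW X → NW X → ∃ (λ y → X ≡ (n , y) × 2 ≤ y × y ≤ m′) → OnBoundary X
    south-side : NE X → NW X → ∃ (λ x → X ≡ (x , 1) × 2 ≤ x × x ≤ n′) → OnBoundary X
    north-side : SW X → SE X → ∃ (λ x → X ≡ (x , m) × 2 ≤ x × x ≤ n′) → OnBoundary X

  boundary-unresolved : ∀ {X Y} → OnBoundary X → OnBoundary Y → Unresolved X Y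
  boundary-unresolved (diagonal-corner X∈NE _ _) (diagonal-corner Y∈NE _ _) = NE-unresolved X∈NE Y∈NE
  boundary-unresolved (diagonal-corner _ _ X≡) (antidiagonal-corner _ _ Y≡) = corner-pair X≡ Y≡
  boundary-unresolved (diagonal-corner X∈NE _ _) (west-side Y∈NE _ _) = NE-unresolved X∈NE Y∈NE
  boundary-unresolved (diagonal-corner _ X∈SW _) (east-side Y∈SW _ _) = SW-unresolved X∈SW Y∈SW
  boundary-unresolved (diagonal-corner X∈NE _ _) (south-side Y∈NE _ _) = NE-unresolved X∈NE Y∈NE
  boundary-unresolved (diagonal-corner _ X∈SW _) (north-side Y∈SW _ _) = SW-unresolved X∈SW Y∈SW
  boundary-unresolved (antidiagonal-corner _ _ X≡) (diagonal-corner _ _ Y≡) = Unresolved-sym (corner-pair Y≡ X≡)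
  boundary-unresolved (antidiagonal-corner X∈SE _ _) (antidiagonal-corner Y∈SE _ _) = SE-unresolved X∈SE Y∈SE
  boundary-unresolved (antidiagonal-corner X∈SE _ _) (west-side _ Y∈SE _) = SE-unresolved X∈SE Y∈SE
  boundary-unresolved (antidiagonal-corner _ X∈NW _) (east-side _ Y∈NW _) = NW-unresolved X∈NW Y∈NW
  boundary-unresolved (antidiagonal-corner _ X∈NW _) (south-side _ Y∈NW _) = NW-unresolved X∈NW Y∈NW
  boundary-unresolved (antidiagonal-corner X∈SE _ _) (north-side _ Y∈SE _) = SE-unresolved X∈SE Y∈SE
  boundary-unresolved (west-side X∈NE _ _) (diagonal-corner Y∈NE _ _) = NE-unresolved X∈NE Y∈NE
  boundary-unresolved (west-side _ X∈SE _) (antidiagonal-corner Y∈SE _ _) = SE-unresolved X∈SE Y∈SE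
  boundary-unresolved (west-side X∈NE _ _) (west-side Y∈NE _ _) = NE-unresolved X∈NE Y∈NE
  boundary-unresolved (west-side _ _ (_ , refl , 2≤y , y≤m′)) (east-side _ _ (_ , refl , 2≤u , u≤m′)) =
    west-east 2≤y y≤m′ 2≤u u≤m′
  boundary-unresolved (west-side X∈NE _ _) (south-side Y∈NE _ _) = NE-unresolved X∈NE Y∈NE
  boundary-unresolved (west-side _ X∈SE _) (north-side _ Y∈SE _) = SE-unresolved X∈SE Y∈SE
  boundary-unresolved (east-side X∈SW _ _) (diagonal-corner _ Y∈SW _) = SW-unresolved X∈SW Y∈SW
  boundary-unresolved (east-side _ X∈NW _) (antidiagonal-corner _ Y∈NW _) = NW-unresolved X∈NW Y∈NW
  boundary-unresolved (east-side _ _ (_ , refl , 2≤y , y≤m′)) (west-side _ _ (_ , refl , 2≤u , u≤m′)) =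
    Unresolved-sym (west-east 2≤u u≤m′ 2≤y y≤m′)
  boundary-unresolved (east-side X∈SW _ _) (east-side Y∈SW _ _) = SW-unresolved X∈SW Y∈SW
  boundary-unresolved (east-side _ X∈NW _) (south-side _ Y∈NW _) = NW-unresolved X∈NW Y∈NW
  boundary-unresolved (east-side X∈SW _ _) (north-side Y∈SW _ _) = SW-unresolved X∈SW Y∈SW
  boundary-unresolved (south-side X∈NE _ _) (diagonal-corner Y∈NE _ _) = NE-unresolved X∈NE Y∈NE
  boundary-unresolved (south-side _ X∈NW _) (antidiagonal-corner _ Y∈NW _) = NW-unresolved X∈NW Y∈NW
  boundary-unresolved (south-side X∈NE _ _) (west-side Y∈NE _ _) = NE-unresolved X∈NE Y∈NE
  boundary-unresolved (south-side _ X∈NW _) (east-side _ Y∈NW _) = NW-unresolved X∈NW Y∈NW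
  boundary-unresolved (south-side X∈NE _ _) (south-side Y∈NE _ _) = NE-unresolved X∈NE Y∈NE
  boundary-unresolved (south-side _ _ (_ , refl , 2≤x , x≤n′)) (north-side _ _ (_ , refl , 2≤u , u≤n′)) =
    south-north 2≤x x≤n′ 2≤u u≤n′
  boundary-unresolved (north-side X∈SW _ _) (diagonal-corner _ Y∈SW _) = SW-unresolved X∈SW Y∈SW
  boundary-unresolved (north-side _ X∈SE _) (antidiagonal-corner Y∈SE _ _) = SE-unresolved X∈SE Y∈SE
  boundary-unresolved (north-side _ X∈SE _) (west-side _ Y∈SE _) = SE-unresolved X∈SE Y∈SE
  boundary-unresolved (north-side X∈SW _ _) (east-side Y∈SW _ _) = SW-unresolved X∈SW Y∈SW
  boundary-unresolved (north-side _ _ (_ , refl , 2≤x , x≤n′)) (south-side _ _ (_ , refl , 2≤u , u≤n′)) =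
    Unresolved-sym (south-north 2≤u u≤n′ 2≤x x≤n′)
  boundary-unresolved (north-side X∈SW _ _) (north-side Y∈SW _ _) = SW-unresolved X∈SW Y∈SW

  interior-or-boundary : ∀ {X} → InGrid X → (∀ Y → Unresolved X Y) ⊎ OnBoundary X
  interior-or-boundary {x , y} (1≤x , x≤n , 1≤y , y≤m) with range {n′} 1≤x x≤n | range {m′} 1≤y y≤m
  ... | first | first = inj₂ (diagonal-corner (inj₁ (1≤n′ , 1≤m′)) (inj₁ (≤-refl , ≤-refl)) (inj₁ refl))
  ... | last | last = inj₂ (diagonal-corner (inj₂ (≤-refl , ≤-refl)) (inj₂ (2≤n , 2≤m)) (inj₂ refl))
  ... | first | last = inj₂ (antidiagonal-corner (inj₁ (1≤n′ , 2≤m)) (inj₁ (≤-refl , ≤-refl)) (inj₁ refl))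
  ... | last | first = inj₂ (antidiagonal-corner (inj₂ (≤-refl , ≤-refl)) (inj₂ (2≤n , 1≤m′)) (inj₂ refl))
  ... | first | inner 2≤y y≤m′ = inj₂ (west-side (inj₁ (1≤n′ , y≤m′)) (inj₁ (1≤n′ , 2≤y)) (y , refl , 2≤y , y≤m′))
  ... | last | inner 2≤y y≤m′ = inj₂ (east-side (inj₂ (2≤n , 2≤y)) (inj₂ (2≤n , y≤m′)) (y , refl , 2≤y , y≤m′))
  ... | inner 2≤x x≤n′ | first = inj₂ (south-side (inj₁ (x≤n′ , 1≤m′)) (inj₂ (2≤x , 1≤m′)) (x , refl , 2≤x , x≤n′))
  ... | inner 2≤x x≤n′ | last = inj₂ (north-side (inj₂ (2≤x , 2≤m)) (inj₁ (x≤n′ , 2≤m)) (x , refl , 2≤x , x≤n′))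
  ... | inner (s≤s 1≤x₀) x≤n′ | inner (s≤s 1≤y₀) y≤m′ =
    inj₁ (λ Y → interior-unresolved Y 1≤x₀ (s≤s x≤n′) 1≤y₀ (s≤s y≤m′))

  all-unresolved : ∀ X Y → InGrid X → InGrid Y → Unresolved X Y
  all-unresolved X Y X∈grid Y∈grid with interior-or-boundary X∈grid | interior-or-boundary Y∈grid
  ... | inj₁ from-X | _ = from-X Y
  ... | inj₂ _ | inj₁ from-Y = Unresolved-sym (from-Y X)
  ... | inj₂ X-boundary | inj₂ Y-boundary = boundary-unresolved X-boundary Y-boundary

module _ {V : Set} {Adj : V → V → Set} where

  _++ʷ_ : ∀ {x y z k l} → Walk Adj x y k → Walk Adj y z l → Walk Adj x z (k + l)
  here ++ʷ w′ = w′
  step e w ++ʷ w′ = step e (w ++ʷ w′)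

  _▷_ : ∀ {x y z k} → Walk Adj x y k → Adj y z → Walk Adj x z (suc k)
  here ▷ e′ = step e′ here
  step e w ▷ e′ = step e (w ▷ e′)

  reverseʷ : (∀ {x y} → Adj x y → Adj y x) → ∀ {x y k} → Walk Adj x y k → Walk Adj y x k
  reverseʷ sym-adj here = here
  reverseʷ sym-adj (step e w) = reverseʷ sym-adj w ▷ sym-adj e

mapʷ : ∀ {V W : Set} {R : V → V → Set} {S : W → W → Set} (f : V → W) →
       (∀ {x y} → R x y → S (f x) (f y)) → ∀ {x y k} → Walk R x y k → Walk S (f x) (f y) k
mapʷ f g here = here
mapʷ f g (step e w) = step (g e) (mapʷ f g w)

module _ {n : ℕ} where

  PathAdj : Fin n → Fin n → Set
  PathAdj i j = ∣ toℕ i - toℕ j ∣ ≡ 1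

  PathAdj-sym : ∀ {i j} → PathAdj i j → PathAdj j i
  PathAdj-sym {i} {j} e = trans (∣-∣-comm (toℕ j) (toℕ i)) e

  path-walk-up : ∀ k {i j : Fin n} → toℕ i + k ≡ toℕ j → Walk PathAdj i j k
  path-walk-up zero {i} e =
    subst (λ j → Walk PathAdj i j 0) (toℕ-injective (trans (sym (+-identityʳ _)) e)) here
  path-walk-up (suc k) {i} {j} e = step i~next (path-walk-up k (trans (cong (_+ k) next≡) e′))
    where
    e′ : suc (toℕ i) + k ≡ toℕ j
    e′ = trans (sym (+-suc (toℕ i) k)) e
    next<n : suc (toℕ i) < n
    next<n = ≤-trans (s≤s (≤-trans (m≤m+n _ k) (≤-reflexive e′))) (toℕ<n j)
    next≡ : toℕ (fromℕ< next<n) ≡ suc (toℕ i)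
    next≡ = toℕ-fromℕ< next<n
    i~next : PathAdj i (fromℕ< next<n)
    i~next = trans (cong ∣ toℕ i -_∣ next≡) (∣n-1+n∣≡1 (toℕ i))

  path-walk : (i j : Fin n) → Walk PathAdj i j ∣ toℕ i - toℕ j ∣
  path-walk i j with ≤-total (toℕ i) (toℕ j)
  ... | inj₁ i≤j = subst (Walk PathAdj i j) (sym (m≤n⇒∣m-n∣≡n∸m i≤j)) (path-walk-up _ (m+[n∸m]≡n i≤j))
  ... | inj₂ j≤i = subst (Walk PathAdj i j) (sym (m≤n⇒∣n-m∣≡n∸m j≤i))
                     (reverseʷ (λ {x} {y} → PathAdj-sym {x} {y}) (path-walk-up _ (m+[n∸m]≡n j≤i)))

point : ∀ {n m} → Vertex n m → Point
point P = xc P , yc P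

grid-walk : ∀ {n m} (P Z : Vertex n m) → Walk GridAdj P Z (manhattan (point P) (point Z))
grid-walk (i , j) (i′ , j′) =
  mapʷ (_, j) (λ e → inj₂ (refl , e)) (path-walk i i′) ++ʷ mapʷ (i′ ,_) (λ e → inj₁ (refl , e)) (path-walk j j′)

GridAdj⇒manhattan≤1 : ∀ {n m} {P Q : Vertex n m} → GridAdj P Q → manhattan (point P) (point Q) ≤ 1
GridAdj⇒manhattan≤1 {Q = Q} (inj₁ (e , e′)) =
  ≤-reflexive (cong₂ _+_ (trans (cong ∣_- xc Q ∣ e) (∣n-n∣≡0 (xc Q))) e′)
GridAdj⇒manhattan≤1 {Q = Q} (inj₂ (e , e′)) =
  ≤-reflexive (trans (cong₂ _+_ e′ (trans (cong ∣_- yc Q ∣ e) (∣n-n∣≡0 (yc Q)))) refl)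

module Distance {n m : ℕ} (E F : Vertex n m) where
  open Shortcut (point E) (point F)

  dist′≤walk : ∀ {P Z k} → Walk (GridAdj+ E F) P Z k → dist′ (point P) (point Z) ≤ k
  dist′≤walk {P} here = ≤-trans (dist′≤manhattan (point P) (point P)) (≤-reflexive (manhattan-self (point P)))
  dist′≤walk {P} {Z} (step {b = Q} (inj₁ PQ) w) =
    ≤-trans (dist′-step (point P) (point Q) (point Z) (GridAdj⇒manhattan≤1 PQ)) (s≤s (dist′≤walk w))
  dist′≤walk {Z = Z} (step (inj₂ (inj₁ (refl , refl))) w) = ≤-trans (dist′-EF (point Z)) (s≤s (dist′≤walk w))
  dist′≤walk {Z = Z} (step (inj₂ (inj₂ (refl , refl))) w) = ≤-trans (dist′-FE (point Z)) (s≤s (dist′≤walk w))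

  Dist⇒≡dist′ : ∀ {P Z k} → Dist (GridAdj+ E F) P Z k → k ≡ dist′ (point P) (point Z)
  Dist⇒≡dist′ {P} {Z} (w , shortest) = ≤-antisym
    (≤dist′ (point P) (point Z)
      (shortest _ (lift (grid-walk P Z)))
      (shortest _ (subst (Walk _ P Z) (+-suc _ _) (lift (grid-walk P E) ++ʷ step E→F (lift (grid-walk F Z)))))
      (shortest _ (subst (Walk _ P Z) (+-suc _ _) (lift (grid-walk P F) ++ʷ step F→E (lift (grid-walk E Z))))))
    (dist′≤walk w)
    where
    lift : ∀ {A B k} → Walk GridAdj A B k → Walk (GridAdj+ E F) A B k
    lift = mapʷ (λ A → A) inj₁
    E→F : GridAdj+ E F E F
    E→F = inj₂ (inj₁ (refl , refl))
    F→E : GridAdj+ E F F E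
    F→E = inj₂ (inj₂ (refl , refl))

module _ {V : Set} {Adj : V → V → Set} where

  Resolving-⊆ : ∀ {R R′ : List V} → (∀ {x} → x ∈ R → x ∈ R′) → Resolving Adj R → Resolving Adj R′
  Resolving-⊆ R⊆R′ resolving A B A≢B with resolving A B A≢B
  ... | x , x∈R , rest = x , R⊆R′ x∈R , rest

  MetricDimAtLeast-3 : V → (∀ X Y → ¬ Resolving Adj (X ∷ Y ∷ [])) → MetricDimAtLeast Adj 3
  MetricDimAtLeast-3 v no-pair [] resolving = ⊥-elim (no-pair v v (Resolving-⊆ (λ ()) resolving))
  MetricDimAtLeast-3 v no-pair (X ∷ []) resolving =
    ⊥-elim (no-pair X X (Resolving-⊆ (λ { (here e) → here e }) resolving))
  MetricDimAtLeast-3 v no-pair (X ∷ Y ∷ []) resolving = ⊥-elim (no-pair X Y resolving)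
  MetricDimAtLeast-3 v no-pair (_ ∷ _ ∷ _ ∷ _) _ = s≤s (s≤s (s≤s z≤n))

module Landmarks {n m : ℕ} (E F : Vertex n m) where
  open Unresolvedness n m (point E) (point F)
  open Distance E F

  vertex : ∀ P → InGrid P → Σ (Vertex n m) λ V → point V ≡ P
  vertex (suc x , suc y) (_ , x≤n , _ , y≤m) =
    (fromℕ< x≤n , fromℕ< y≤m) , cong₂ (λ i j → suc i , suc j) (toℕ-fromℕ< x≤n) (toℕ-fromℕ< y≤m)

  point∈grid : ∀ V → InGrid (point V)
  point∈grid (i , j) = s≤s z≤n , toℕ<n i , s≤s z≤n , toℕ<n j

  pair-not-resolving : ∀ X Y → Unresolved (point X) (point Y) → ¬ Resolving (GridAdj+ E F) (X ∷ Y ∷ [])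
  pair-not-resolving X Y (unresolved A B A∈ B∈ A≢B agree-X agree-Y) resolving
    with vertex A A∈ | vertex B B∈
  ... | A′ , refl | B′ , refl with resolving A′ B′ (A≢B ∘ cong point)
  ... | _ , here refl , _ , _ , dA , dB , k≢l =
    k≢l (trans (Dist⇒≡dist′ dA) (trans agree-X (sym (Dist⇒≡dist′ dB))))
  ... | _ , there (here refl) , _ , _ , dA , dB , k≢l =
    k≢l (trans (Dist⇒≡dist′ dA) (trans agree-Y (sym (Dist⇒≡dist′ dB))))

lemma4 : (n m : ℕ) (E F : Vertex n m) →
    xc F ≤ xc E → yc E ≤ yc F → xc E ∸ xc F ≤ yc F ∸ yc E →
    ¬ (xc F ≡ xc E) →
    2 ≤ ∣ ∣ yc F - yc E ∣ - ∣ xc E - xc F ∣ ∣ ∸ 1 →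
    1 < xc E → xc E < n → 1 < xc F → xc F < n →
    1 < yc E → yc E < m → 1 < yc F → yc F < m →
    MetricDimAtLeast (GridAdj+ E F) 3
lemma4 _ _ E F xF≤xE yE≤yF slopes xF≢xE Gain′ _ xE<n@(s≤s _) 1<xF _ 1<yE _ _ yF<m@(s≤s _) =
  MetricDimAtLeast-3 E λ X Y →
    pair-not-resolving X Y (all-unresolved (point X) (point Y) (point∈grid X) (point∈grid Y))
  where
  open Landmarks E F
  open Configuration _ _ (toℕ (proj₁ E)) (toℕ (proj₂ E)) (toℕ (proj₁ F)) (toℕ (proj₂ F))
    (≤-pred 1<xF) (≤∧≢⇒< xF≤xE xF≢xE) xE<n (≤-pred 1<yE) yF<m (gain-from-Gain′ xF≤xE yE≤yF slopes Gain′)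
    using (all-unresolved)
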